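{- There are sequents which are theorems of $\mathrm{ML}$ but not theorems of $\mathrm{PL}+{\to}\mathrm{ED}$, and there are sequents which are theorems of $\mathrm{PL}+{\to}\mathrm{ED}$ but not theorems of $\mathrm{CL}$.
   Context: Formulas are built from propositional variables and constants $\top,\bot$ using $\land$ and $\to$; a sequent is $\Gamma\vdash\phi$ with $\Gamma$ a finite list of formulas. $\mathrm{PL}$ has the rules: $\vdash\top$; $\phi\vdash\phi$; from $\Gamma\vdash\psi$ infer $\Gamma,\phi\vdash\psi$; from $\Gamma\vdash\phi$ and $\Gamma,\phi\vdash\psi$ infer $\Gamma\vdash\psi$; from $\Gamma\vdash\phi\land\psi$ infer $\Gamma\vdash\phi$ and $\Gamma\vdash\psi$; from $\Gamma\vdash\phi$ and $\Gamma\vdash\psi$ infer $\Gamma\vdash\phi\land\psi$; from $\Gamma\vdash\phi$ and $\Gamma\vdash\phi\to\psi$ infer $\Gamma\vdash\psi$; from $\Gamma\vdash\psi$ infer $\Gamma\vdash\phi\to\psi$. $\mathrm{PL}+{\to}\mathrm{ED}$ is $\mathrm{PL}$ plus: from $\Gamma\vdash\phi\to\psi$ infer $\Gamma\vdash\psi$. $\mathrm{ML}$ is $\mathrm{PL}$ plus: from $\Gamma,\phi\vdash\psi$ infer $\Gamma\vdash\phi\to\psi$. $\mathrm{IL}$ is $\mathrm{ML}$ plus the axiom $\bot\vdash\phi$. $\mathrm{CL}$ is $\mathrm{IL}$ plus: from $\Gamma,\phi\vdash\psi$ and $\Gamma,(\phi\to\bot)\vdash\psi$ infer $\Gamma\vdash\psi$.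 -}

module Defs where

open import Data.Nat using (ℕ)
open import Data.Product using (Σ; _×_)
open import Relation.Nullary using (¬_)

data Fm : Set where
  var  : ℕ → Fm
  ⊤'   : Fm
  ⊥'   : Fm
  _∧'_ : Fm → Fm → Fm
  _⇒_  : Fm → Fm → Fm

infixr 6 _∧'_
infixr 5 _⇒_

data Ctx : Set where
  ∅   : Ctx
  _,_ : Ctx → Fm → Ctx

infixl 4 _,_

record Sequent : Set where
  constructor _⊢_
  field
    ctx : Ctx
    goal : Fm

infix 3 _⊢_

data PL : Ctx → Fm → Set where
  ⊤-ax : PL ∅ ⊤'
  id   : ∀ φ → PL (∅ , φ) φ
  wk   : ∀ {Γ ψ} φ → PL Γ ψ → PL (Γ , φ) ψ
  cut  : ∀ {Γ φ ψ} → PL Γ φ → PL (Γ , φ) ψ → PL Γ ψ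
  ∧E₁  : ∀ {Γ φ ψ} → PL Γ (φ ∧' ψ) → PL Γ φ
  ∧E₂  : ∀ {Γ φ ψ} → PL Γ (φ ∧' ψ) → PL Γ ψ
  ∧I   : ∀ {Γ φ ψ} → PL Γ φ → PL Γ ψ → PL Γ (φ ∧' ψ)
  ⇒E   : ∀ {Γ φ ψ} → PL Γ φ → PL Γ (φ ⇒ ψ) → PL Γ ψ
  ⇒K   : ∀ {Γ ψ} φ → PL Γ ψ → PL Γ (φ ⇒ ψ)

data PLED : Ctx → Fm → Set where
  ⊤-ax : PLED ∅ ⊤'
  id   : ∀ φ → PLED (∅ , φ) φ
  wk   : ∀ {Γ ψ} φ → PLED Γ ψ → PLED (Γ , φ) ψ
  cut  : ∀ {Γ φ ψ} → PLED Γ φ → PLED (Γ , φ) ψ → PLED Γ ψ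
  ∧E₁  : ∀ {Γ φ ψ} → PLED Γ (φ ∧' ψ) → PLED Γ φ
  ∧E₂  : ∀ {Γ φ ψ} → PLED Γ (φ ∧' ψ) → PLED Γ ψ
  ∧I   : ∀ {Γ φ ψ} → PLED Γ φ → PLED Γ ψ → PLED Γ (φ ∧' ψ)
  ⇒E   : ∀ {Γ φ ψ} → PLED Γ φ → PLED Γ (φ ⇒ ψ) → PLED Γ ψ
  ⇒K   : ∀ {Γ ψ} φ → PLED Γ ψ → PLED Γ (φ ⇒ ψ)
  ⇒ED  : ∀ {Γ φ ψ} → PLED Γ (φ ⇒ ψ) → PLED Γ ψ

data ML : Ctx → Fm → Set where
  ⊤-ax : ML ∅ ⊤'
  id   : ∀ φ → ML (∅ , φ) φ
  wk   : ∀ {Γ ψ} φ → ML Γ ψ → ML (Γ , φ) ψ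
  cut  : ∀ {Γ φ ψ} → ML Γ φ → ML (Γ , φ) ψ → ML Γ ψ
  ∧E₁  : ∀ {Γ φ ψ} → ML Γ (φ ∧' ψ) → ML Γ φ
  ∧E₂  : ∀ {Γ φ ψ} → ML Γ (φ ∧' ψ) → ML Γ ψ
  ∧I   : ∀ {Γ φ ψ} → ML Γ φ → ML Γ ψ → ML Γ (φ ∧' ψ)
  ⇒E   : ∀ {Γ φ ψ} → ML Γ φ → ML Γ (φ ⇒ ψ) → ML Γ ψ
  ⇒K   : ∀ {Γ ψ} φ → ML Γ ψ → ML Γ (φ ⇒ ψ)
  ⇒I   : ∀ {Γ φ ψ} → ML (Γ , φ) ψ → ML Γ (φ ⇒ ψ)

data CL : Ctx → Fm → Set where
  ⊤-ax : CL ∅ ⊤'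
  id   : ∀ φ → CL (∅ , φ) φ
  wk   : ∀ {Γ ψ} φ → CL Γ ψ → CL (Γ , φ) ψ
  cut  : ∀ {Γ φ ψ} → CL Γ φ → CL (Γ , φ) ψ → CL Γ ψ
  ∧E₁  : ∀ {Γ φ ψ} → CL Γ (φ ∧' ψ) → CL Γ φ
  ∧E₂  : ∀ {Γ φ ψ} → CL Γ (φ ∧' ψ) → CL Γ ψ
  ∧I   : ∀ {Γ φ ψ} → CL Γ φ → CL Γ ψ → CL Γ (φ ∧' ψ)
  ⇒E   : ∀ {Γ φ ψ} → CL Γ φ → CL Γ (φ ⇒ ψ) → CL Γ ψ
  ⇒K   : ∀ {Γ ψ} φ → CL Γ ψ → CL Γ (φ ⇒ ψ)
  ⇒I   : ∀ {Γ φ ψ} → CL (Γ , φ) ψ → CL Γ (φ ⇒ ψ)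
  ⊥-ax : ∀ φ → CL (∅ , ⊥') φ
  em   : ∀ {Γ φ ψ} → CL (Γ , φ) ψ → CL (Γ , (φ ⇒ ⊥')) ψ → CL Γ ψ

ThmPL ThmPLED ThmML ThmCL : Sequent → Set
ThmPL   (Γ ⊢ φ) = PL Γ φ
ThmPLED (Γ ⊢ φ) = PLED Γ φ
ThmML   (Γ ⊢ φ) = ML Γ φ
ThmCL   (Γ ⊢ φ) = CL Γ φ

module Submission where

open import Data.Bool using (Bool; false; T)
open import Data.Empty using (⊥; ⊥-elim)
open import Data.Nat using (ℕ)
open import Data.Product using (Σ; _×_; proj₁; proj₂) renaming (_,_ to _,,_)
open import Data.Unit using (⊤; tt)
open import Relation.Nullary using (¬_; Dec; yes; no)
open import Relation.Nullary.Decidable using (T?; _×-dec_; _→-dec_)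

open import Defs

-- Both separations are by soundness for a model that refutes the other sequent.
-- In PL + →ED an implication is never discharged by an assumption, so reading
-- φ ⇒ ψ as ψ is sound, while it refutes ∅ ⊢ p ⇒ p once p is false.  Conversely,
-- p ⇒ q ⊢ q is refuted classically by p and q false.

Sat : (Fm → Set) → Ctx → Set
Sat ⟦_⟧ ∅       = ⊤
Sat ⟦_⟧ (Γ , φ) = Sat ⟦_⟧ Γ × ⟦ φ ⟧

⟦_⟧ᴱᴰ_ : Fm → (ℕ → Set) → Set
⟦ var i  ⟧ᴱᴰ ρ = ρ i
⟦ ⊤'     ⟧ᴱᴰ ρ = ⊤
⟦ ⊥'     ⟧ᴱᴰ ρ = ⊥
⟦ φ ∧' ψ ⟧ᴱᴰ ρ = ⟦ φ ⟧ᴱᴰ ρ × ⟦ ψ ⟧ᴱᴰ ρ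
⟦ φ ⇒ ψ  ⟧ᴱᴰ ρ = ⟦ ψ ⟧ᴱᴰ ρ

PLED-sound : ∀ ρ {Γ φ} → PLED Γ φ → Sat (⟦_⟧ᴱᴰ ρ) Γ → ⟦ φ ⟧ᴱᴰ ρ
PLED-sound ρ ⊤-ax      γ = tt
PLED-sound ρ (id φ)    γ = proj₂ γ
PLED-sound ρ (wk φ d)  γ = PLED-sound ρ d (proj₁ γ)
PLED-sound ρ (cut d e) γ = PLED-sound ρ e (γ ,, PLED-sound ρ d γ)
PLED-sound ρ (∧E₁ d)   γ = proj₁ (PLED-sound ρ d γ)
PLED-sound ρ (∧E₂ d)   γ = proj₂ (PLED-sound ρ d γ)
PLED-sound ρ (∧I d e)  γ = PLED-sound ρ d γ ,, PLED-sound ρ e γ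
PLED-sound ρ (⇒E d e)  γ = PLED-sound ρ e γ
PLED-sound ρ (⇒K φ d)  γ = PLED-sound ρ d γ
PLED-sound ρ (⇒ED d)   γ = PLED-sound ρ d γ

⟦_⟧ᶜ_ : Fm → (ℕ → Bool) → Set
⟦ var i  ⟧ᶜ ρ = T (ρ i)
⟦ ⊤'     ⟧ᶜ ρ = ⊤
⟦ ⊥'     ⟧ᶜ ρ = ⊥
⟦ φ ∧' ψ ⟧ᶜ ρ = ⟦ φ ⟧ᶜ ρ × ⟦ ψ ⟧ᶜ ρ
⟦ φ ⇒ ψ  ⟧ᶜ ρ = ⟦ φ ⟧ᶜ ρ → ⟦ ψ ⟧ᶜ ρ

⟦_⟧ᶜ?_ : ∀ φ ρ → Dec (⟦ φ ⟧ᶜ ρ)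
⟦ var i  ⟧ᶜ? ρ = T? (ρ i)
⟦ ⊤'     ⟧ᶜ? ρ = yes tt
⟦ ⊥'     ⟧ᶜ? ρ = no λ ()
⟦ φ ∧' ψ ⟧ᶜ? ρ = (⟦ φ ⟧ᶜ? ρ) ×-dec (⟦ ψ ⟧ᶜ? ρ)
⟦ φ ⇒ ψ  ⟧ᶜ? ρ = (⟦ φ ⟧ᶜ? ρ) →-dec (⟦ ψ ⟧ᶜ? ρ)

CL-sound : ∀ ρ {Γ φ} → CL Γ φ → Sat (⟦_⟧ᶜ ρ) Γ → ⟦ φ ⟧ᶜ ρ
CL-sound ρ ⊤-ax      γ = tt
CL-sound ρ (id φ)    γ = proj₂ γ
CL-sound ρ (wk φ d)  γ = CL-sound ρ d (proj₁ γ)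
CL-sound ρ (cut d e) γ = CL-sound ρ e (γ ,, CL-sound ρ d γ)
CL-sound ρ (∧E₁ d)   γ = proj₁ (CL-sound ρ d γ)
CL-sound ρ (∧E₂ d)   γ = proj₂ (CL-sound ρ d γ)
CL-sound ρ (∧I d e)  γ = CL-sound ρ d γ ,, CL-sound ρ e γ
CL-sound ρ (⇒E d e)  γ = CL-sound ρ e γ (CL-sound ρ d γ)
CL-sound ρ (⇒K φ d)  γ = λ _ → CL-sound ρ d γ
CL-sound ρ (⇒I d)    γ = λ x → CL-sound ρ d (γ ,, x)
CL-sound ρ (⊥-ax φ)  γ = ⊥-elim (proj₂ γ)
CL-sound ρ (em {φ = φ} d e) γ with ⟦ φ ⟧ᶜ? ρ
... | yes x = CL-sound ρ d (γ ,, x)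
... | no ¬x = CL-sound ρ e (γ ,, ¬x)

lemma5p1 : Σ Sequent (λ s → ThmML s × ¬ ThmPLED s) × Σ Sequent (λ s → ThmPLED s × ¬ ThmCL s)
lemma5p1 = ((∅ ⊢ p ⇒ p) ,, ⇒I (id p) ,, λ d → PLED-sound (λ _ → ⊥) d tt)
        ,, ((∅ , p ⇒ q ⊢ q) ,, ⇒ED (id (p ⇒ q)) ,, λ d → CL-sound (λ _ → false) d (tt ,, λ ()))
  where
    p q : Fm
    p = var 0
    q = var 1
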